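{- Let $n>8$ and let $G$ be a divisible design graph with parameters $(4n,n+2,n-2,2,4,n)$ with quotient matrix $R$ of its canonical partition. If $(a,b,c,d)$ is a row of $R$, then the multiset $\{a,b,c,d\}$ equals $\{n-1,1,1,1\}$.
   Context: A divisible design graph (DDG) with parameters $(v,k,\lambda_1,\lambda_2,m,n)$ is a $k$-regular graph on $v=mn$ vertices whose vertex set can be partitioned into $m$ classes of size $n$ (a canonical partition) such that any two distinct vertices in the same class have exactly $\lambda_1$ common neighbours and any two vertices in different classes have exactly $\lambda_2$ common neighbours. For $\lambda_1\neq\lambda_2$ the canonical partition is equitable: each vertex of class $V_i$ has the same number $r_{ij}$ of neighbours in class $V_j$; $R=(r_{ij})$ is the quotient matrix. -}

module Defs where

open import Data.Nat using (ℕ; suc; _*_)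
open import Data.Bool using (Bool; true; false; _∧_)
open import Data.Fin using (Fin; _≟_)
open import Data.List using (List; allFin; filter; length; map)
open import Relation.Binary.PropositionalEquality using (_≡_; _≢_)
open import Relation.Nullary using (Dec)
open import Relation.Nullary.Decidable using (⌊_⌋)
open import Data.Product using (_×_; Σ)

record Graph (v : ℕ) : Set where
  field
    adj   : Fin v → Fin v → Bool
    sym   : ∀ x y → adj x y ≡ adj y x
    irrefl : ∀ x → adj x x ≡ false
open Graph public

countB : ∀ {v} → (Fin v → Bool) → ℕ
countB {v} p = length (filter (λ x → p x Data.Bool.≟ true) (allFin v))

degree : ∀ {v} → Graph v → Fin v → ℕ
degree G x = countB (adj G x)

commonNbrs : ∀ {v} → Graph v → Fin v → Fin v → ℕ
commonNbrs G x y = countB (λ z → adj G x z ∧ adj G y z)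

classSize : ∀ {v m} → (Fin v → Fin m) → Fin m → ℕ
classSize {v} cls i = countB (λ x → ⌊ cls x ≟ i ⌋)

nbrsIn : ∀ {v m} → Graph v → (Fin v → Fin m) → Fin v → Fin m → ℕ
nbrsIn G cls x j = countB (λ z → adj G x z ∧ ⌊ cls z ≟ j ⌋)

record IsDDG {v : ℕ} (G : Graph v) (k λ₁ λ₂ m n : ℕ) (cls : Fin v → Fin m) : Set where
  field
    order     : v ≡ m * n
    regular   : ∀ x → degree G x ≡ k
    classSz   : ∀ i → classSize cls i ≡ n
    sameClass : ∀ x y → x ≢ y → cls x ≡ cls y → commonNbrs G x y ≡ λ₁
    diffClass : ∀ x y → cls x ≢ cls y → commonNbrs G x y ≡ λ₂

-- The row of the quotient matrix R for the class of x: (r_{i j})_j with i = cls x,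
-- i.e. the number of neighbours of x in each class V_j (as a list over j).
quotientRow : ∀ {v m} → Graph v → (Fin v → Fin m) → Fin v → List ℕ
quotientRow {m = m} G cls x = map (nbrsIn G cls x) (allFin m)

-- The DDG conditions say that A² + λ₁ I = λ₂ J + (λ₁ − λ₂) K + k I, where A is the adjacency
-- matrix and K is the indicator of lying in a common class. Writing r j x for the number of
-- neighbours of x in V_j and evaluating A³ on the indicator of V_j both as A (A² ·) and as A² (A ·)
-- gives n · r j x = (number of edges between the class of x and V_j), so the canonical partition
-- is equitable and its quotient matrix R is symmetric. Hence a row of R satisfies Σ r = k and,
-- since Σ_j r_ij r_ji counts the walks of length 2 from x back into its own class,
-- Σ r² = k + λ₁ (n − 1).
-- For (k, λ₁) = (n + 2, n − 2) these read Σ r = n + 2 and Σ r² = n² − 2n + 4. Some entry a is then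
-- at least n − 3 (otherwise Σ r² ≤ (n − 4)(n + 2)), and the other three entries, with sum s ≤ 5
-- and square-sum q ≤ s², satisfy 6n + q + s² = 2s(n + 2). This forces s = q = 3, i.e. the other
-- entries are 1, 1, 1; the case s = 4 (q = 2n ≤ 16) is excluded exactly by n > 8.
module Submission where

open import Defs hiding (sym)
open import Data.Nat using (ℕ; zero; suc; _+_; _*_; _∸_; _≤_; _<_; _>_; _≤?_; z≤n; s≤s; NonZero; >-nonZero)
open import Data.Nat.Properties hiding (_≟_)
open import Data.Nat.ListAction using (sum)
open import Data.Nat.ListAction.Properties using (sum-↭)
open import Data.Nat.Tactic.RingSolver using (solve-∀)
open import Algebra.Properties.CommutativeSemigroup *-commutativeSemigroup using (x∙yz≈y∙xz)
open import Algebra.Properties.Semiring.Sum +-*-semiring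
  using (sum-syntax; sum-cong-≗; sum-replicate-zero; ∑-comm; ∑-distrib-+; *-distribˡ-sum; *-distribʳ-sum)
open import Data.Bool using (Bool; true; false; _∧_)
import Data.Bool as Bool
open import Data.Fin using (Fin; zero; suc; _≟_)
open import Data.List using (List; []; _∷_; _++_; map; filter; length; replicate; tabulate; allFin)
open import Data.List.Properties using (map-∘)
open import Data.List.Relation.Unary.All using (All; []; _∷_; all?)
open import Data.List.Relation.Unary.All.Properties using (¬All⇒Any¬)
open import Data.List.Relation.Unary.Any as Any using (Any)
open import Data.List.Membership.Propositional using (_∈_; find)
open import Data.List.Membership.Propositional.Properties using (∈-∃++)
open import Data.List.Relation.Binary.Permutation.Propositional using (_↭_; ↭-trans; ↭-reflexive)
open import Data.List.Relation.Binary.Permutation.Propositional.Properties using (shift; ↭-length; map⁺)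
open import Data.Product using (_×_; _,_; ∃; proj₁; proj₂)
open import Relation.Binary.PropositionalEquality
  using (_≡_; _≢_; refl; sym; trans; cong; cong₂; subst; module ≡-Reasoning)
open import Relation.Nullary using (yes; no; contradiction)
open import Relation.Nullary.Decidable using (⌊_⌋)

-- Rows of four naturals with prescribed sum and sum of squares

∈⇒↭∷ : ∀ {A : Set} {a : A} {xs} → a ∈ xs → ∃ λ ys → xs ↭ a ∷ ys
∈⇒↭∷ a∈xs with ys , zs , refl ← ∈-∃++ a∈xs = ys ++ zs , shift _ ys zs

All-≡⇒replicate : ∀ {A : Set} {x : A} {xs} → All (_≡ x) xs → xs ≡ replicate (length xs) x
All-≡⇒replicate []           = refl
All-≡⇒replicate (refl ∷ eqs) = cong (_ ∷_) (All-≡⇒replicate eqs)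

sumOfSquares : List ℕ → ℕ
sumOfSquares xs = sum (map (λ x → x * x) xs)

sumOfSquares-↭ : ∀ {xs ys} → xs ↭ ys → sumOfSquares xs ≡ sumOfSquares ys
sumOfSquares-↭ xs↭ys = sum-↭ (map⁺ _ xs↭ys)

sumOfSquares≤sum*sum : ∀ xs → sumOfSquares xs ≤ sum xs * sum xs
sumOfSquares≤sum*sum []       = z≤n
sumOfSquares≤sum*sum (x ∷ xs) = begin
  x * x + sumOfSquares xs           ≤⟨ +-monoʳ-≤ (x * x) (sumOfSquares≤sum*sum xs) ⟩
  x * x + s * s                     ≤⟨ m≤m+n (x * x + s * s) (2 * x * s) ⟩
  x * x + s * s + 2 * x * s         ≡⟨ expand x s ⟩
  (x + s) * (x + s)                 ∎
  where
  open ≤-Reasoning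
  s : ℕ
  s = sum xs
  expand : ∀ x s → x * x + s * s + 2 * x * s ≡ (x + s) * (x + s)
  expand = solve-∀

sumOfSquares+c*sum≤N*sum : ∀ c N xs → All (λ x → c + x ≤ N) xs →
                           sumOfSquares xs + c * sum xs ≤ N * sum xs
sumOfSquares+c*sum≤N*sum c N []       []         = ≤-reflexive (trans (*-zeroʳ c) (sym (*-zeroʳ N)))
sumOfSquares+c*sum≤N*sum c N (x ∷ xs) (x≤ ∷ xs≤) = begin
  x * x + q + c * (x + s)           ≡⟨ regroup x q c s ⟩
  (c + x) * x + (q + c * s)         ≤⟨ +-mono-≤ (*-monoˡ-≤ x x≤) (sumOfSquares+c*sum≤N*sum c N xs xs≤) ⟩
  N * x + N * s                     ≡⟨ *-distribˡ-+ N x s ⟨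
  N * (x + s)                       ∎
  where
  open ≤-Reasoning
  q s : ℕ
  q = sumOfSquares xs
  s = sum xs
  regroup : ∀ x q c s → x * x + q + c * (x + s) ≡ (c + x) * x + (q + c * s)
  regroup = solve-∀

large-entry : ∀ c N xs → N * sum xs < sumOfSquares xs + c * sum xs → Any (λ x → N < c + x) xs
large-entry c N xs excess with all? (λ x → c + x ≤? N) xs
... | yes small  = contradiction (sumOfSquares+c*sum≤N*sum c N xs small) (<⇒≱ excess)
... | no ¬small = Any.map ≰⇒> (¬All⇒Any¬ (λ x → c + x ≤? N) xs ¬small)

2*m≤m*m+1 : ∀ m → 2 * m ≤ m * m + 1
2*m≤m*m+1 zero    = z≤n
2*m≤m*m+1 (suc m) = subst (2 * suc m ≤_) (expand m) (m≤m+n (2 * suc m) (m * m))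
  where
  expand : ∀ m → 2 * suc m + m * m ≡ suc m * suc m + 1
  expand = solve-∀

m*m+1≡2*m⇒m≡1 : ∀ m → m * m + 1 ≡ 2 * m → m ≡ 1
m*m+1≡2*m⇒m≡1 (suc zero)    _  = refl
m*m+1≡2*m⇒m≡1 (suc (suc m)) eq = contradiction (trans (expand m) eq) (m+1+n≢m (2 * (2 + m)))
  where
  expand : ∀ m → 2 * (2 + m) + suc (m * (2 + m)) ≡ (2 + m) * (2 + m) + 1
  expand = solve-∀

2*sum≤sumOfSquares+length : ∀ xs → 2 * sum xs ≤ sumOfSquares xs + length xs
2*sum≤sumOfSquares+length []       = z≤n
2*sum≤sumOfSquares+length (x ∷ xs) = begin
  2 * (x + sum xs)                          ≡⟨ *-distribˡ-+ 2 x (sum xs) ⟩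
  2 * x + 2 * sum xs                        ≤⟨ +-mono-≤ (2*m≤m*m+1 x) (2*sum≤sumOfSquares+length xs) ⟩
  x * x + 1 + (sumOfSquares xs + length xs) ≡⟨ regroup (x * x) (sumOfSquares xs) (length xs) ⟩
  x * x + sumOfSquares xs + suc (length xs) ∎
  where
  open ≤-Reasoning
  regroup : ∀ a q l → a + 1 + (q + l) ≡ a + q + suc l
  regroup = solve-∀

≤-+-≡⇒≡ : ∀ {a b c d} → b ≤ a → d ≤ c → a + c ≡ b + d → a ≡ b × c ≡ d
≤-+-≡⇒≡ {a} {b} {c} {d} b≤a d≤c eq =
  ≤-antisym (+-cancelʳ-≤ c a b (≤-trans (≤-reflexive eq) (+-monoʳ-≤ b d≤c))) b≤a ,
  ≤-antisym (+-cancelˡ-≤ a c d (≤-trans (≤-reflexive eq) (+-monoˡ-≤ d b≤a))) d≤c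

-- The equality case of Σ 2x ≤ Σ (x² + 1), i.e. of Σ (x − 1)² ≥ 0.
sumOfSquares+length≡2*sum⇒ones : ∀ xs → sumOfSquares xs + length xs ≡ 2 * sum xs → All (_≡ 1) xs
sumOfSquares+length≡2*sum⇒ones []       _  = []
sumOfSquares+length≡2*sum⇒ones (x ∷ xs) eq =
  m*m+1≡2*m⇒m≡1 x (proj₁ split) ∷ sumOfSquares+length≡2*sum⇒ones xs (proj₂ split)
  where
  q l s : ℕ
  q = sumOfSquares xs
  l = length xs
  s = sum xs
  regroup : ∀ a q l → a + 1 + (q + l) ≡ a + q + suc l
  regroup = solve-∀
  regrouped : x * x + 1 + (q + l) ≡ 2 * x + 2 * s
  regrouped = begin
    x * x + 1 + (q + l) ≡⟨ regroup (x * x) q l ⟩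
    x * x + q + suc l   ≡⟨ eq ⟩
    2 * (x + s)         ≡⟨ *-distribˡ-+ 2 x s ⟩
    2 * x + 2 * s       ∎
    where open ≡-Reasoning
  split : x * x + 1 ≡ 2 * x × q + l ≡ 2 * s
  split = ≤-+-≡⇒≡ (2*m≤m*m+1 x) (2*sum≤sumOfSquares+length xs) regrouped

-- From here on n = 9 + t, which makes every constraint a polynomial identity in t
-- free of truncated subtraction.
tail-cases : ∀ t q s → s ≤ 5 → q ≤ s * s → 6 * (9 + t) + q + s * s ≡ 2 * s * (9 + t + 2) → s ≡ 3 × q ≡ 3
tail-cases t q 0 _ _ ()
tail-cases t q 1 _ _ eq = contradiction (trans (expand t q) (trans eq (expand′ t))) (m+1+n≢m (22 + 2 * t))
  where
  expand : ∀ t q → 22 + 2 * t + suc (32 + 4 * t + q) ≡ 6 * (9 + t) + q + 1 * 1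
  expand = solve-∀
  expand′ : ∀ t → 2 * 1 * (9 + t + 2) ≡ 22 + 2 * t
  expand′ = solve-∀
tail-cases t q 2 _ _ eq = contradiction (trans (expand t q) (trans eq (expand′ t))) (m+1+n≢m (44 + 4 * t))
  where
  expand : ∀ t q → 44 + 4 * t + suc (13 + 2 * t + q) ≡ 6 * (9 + t) + q + 2 * 2
  expand = solve-∀
  expand′ : ∀ t → 2 * 2 * (9 + t + 2) ≡ 44 + 4 * t
  expand′ = solve-∀
tail-cases t q 3 _ _ eq = refl , +-cancelˡ-≡ (63 + 6 * t) q 3 (trans (expand t q) (trans eq (expand′ t)))
  where
  expand : ∀ t q → 63 + 6 * t + q ≡ 6 * (9 + t) + q + 3 * 3
  expand = solve-∀
  expand′ : ∀ t → 2 * 3 * (9 + t + 2) ≡ 63 + 6 * t + 3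
  expand′ = solve-∀
tail-cases t q 4 _ q≤16 eq = contradiction (subst (_≤ 16) q≡ q≤16) (m+1+n≰m 16)
  where
  expand : ∀ t q → 70 + 6 * t + q ≡ 6 * (9 + t) + q + 4 * 4
  expand = solve-∀
  expand′ : ∀ t → 2 * 4 * (9 + t + 2) ≡ 70 + 6 * t + (18 + 2 * t)
  expand′ = solve-∀
  q≡ : q ≡ 18 + 2 * t
  q≡ = +-cancelˡ-≡ (70 + 6 * t) q _ (trans (expand t q) (trans eq (expand′ t)))
tail-cases t q 5 _ q≤25 eq = contradiction (subst (_≤ 25) q≡ q≤25) (m+1+n≰m 25)
  where
  expand : ∀ t q → 79 + 6 * t + q ≡ 6 * (9 + t) + q + 5 * 5
  expand = solve-∀
  expand′ : ∀ t → 2 * 5 * (9 + t + 2) ≡ 79 + 6 * t + (31 + 4 * t)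
  expand′ = solve-∀
  q≡ : q ≡ 31 + 4 * t
  q≡ = +-cancelˡ-≡ (79 + 6 * t) q _ (trans (expand t q) (trans eq (expand′ t)))
tail-cases t q (suc (suc (suc (suc (suc (suc _)))))) (s≤s (s≤s (s≤s (s≤s (s≤s ()))))) _ _

tail-moments : ∀ t a s q → 6 + t ≤ a → q ≤ s * s → a + s ≡ 9 + t + 2 →
               a * a + q + (7 + t) ≡ (7 + t) * (9 + t) + (9 + t + 2) → s ≡ 3 × q ≡ 3
tail-moments t a s q large q≤s*s sum≡ squares≡ = tail-cases t q s s≤5 q≤s*s key
  where
  N l : ℕ
  N = 9 + t
  l = 7 + t
  s≤5 : s ≤ 5
  s≤5 = +-cancelˡ-≤ (6 + t) s 5 (begin
    6 + t + s   ≤⟨ +-monoˡ-≤ s large ⟩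
    a + s       ≡⟨ sum≡ ⟩
    N + 2       ≡⟨ shift-five t ⟩
    6 + t + 5   ∎)
    where
    open ≤-Reasoning
    shift-five : ∀ t → 9 + t + 2 ≡ 6 + t + 5
    shift-five = solve-∀
  swap-sides : ∀ N q s a l → 6 * N + q + s * s + (a * a + l) ≡ (a * a + q + l) + (6 * N + s * s)
  swap-sides = solve-∀
  complete-square : ∀ t s → (7 + t) * (9 + t) + (9 + t + 2) + (6 * (9 + t) + s * s)
                          ≡ (9 + t + 2) * (9 + t + 2) + s * s + (7 + t)
  complete-square = solve-∀
  expand-square : ∀ a s l → (a + s) * (a + s) + s * s + l ≡ 2 * s * (a + s) + (a * a + l)
  expand-square = solve-∀
  key : 6 * N + q + s * s ≡ 2 * s * (N + 2)
  key = +-cancelʳ-≡ (a * a + l) _ _ (begin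
    6 * N + q + s * s + (a * a + l)       ≡⟨ swap-sides N q s a l ⟩
    a * a + q + l + (6 * N + s * s)       ≡⟨ cong (_+ (6 * N + s * s)) squares≡ ⟩
    l * N + (N + 2) + (6 * N + s * s)     ≡⟨ complete-square t s ⟩
    (N + 2) * (N + 2) + s * s + l         ≡⟨ cong (λ u → u * u + s * s + l) sum≡ ⟨
    (a + s) * (a + s) + s * s + l         ≡⟨ expand-square a s l ⟩
    2 * s * (a + s) + (a * a + l)         ≡⟨ cong (λ u → 2 * s * u + (a * a + l)) sum≡ ⟩
    2 * s * (N + 2) + (a * a + l)         ∎)
    where open ≡-Reasoning

square-excess : ∀ t {S Q} → S ≡ 9 + t + 2 → Q + (7 + t) ≡ (7 + t) * (9 + t) + (9 + t + 2) →
                (9 + t) * S < Q + 4 * S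
square-excess t {S} {Q} refl squares≡ = subst ((9 + t) * S <_) Q+4S≡ (m<m+n ((9 + t) * S) {12} (s≤s z≤n))
  where
  regroup : ∀ t Q → Q + 4 * (9 + t + 2) + (7 + t) ≡ Q + (7 + t) + 4 * (9 + t + 2)
  regroup = solve-∀
  expand : ∀ t → (7 + t) * (9 + t) + (9 + t + 2) + 4 * (9 + t + 2) ≡ (9 + t) * (9 + t + 2) + 12 + (7 + t)
  expand = solve-∀
  Q+4S≡ : (9 + t) * S + 12 ≡ Q + 4 * S
  Q+4S≡ = sym (+-cancelʳ-≡ (7 + t) _ _ (trans (regroup t Q) (trans (cong (_+ 4 * S) squares≡) (expand t))))

row-determined-by-moments : ∀ {n} xs → 8 < n → length xs ≡ 4 → sum xs ≡ n + 2 →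
                            sumOfSquares xs + (n ∸ 2) ≡ (n ∸ 2) * n + (n + 2) →
                            xs ↭ n ∸ 1 ∷ 1 ∷ 1 ∷ 1 ∷ []
row-determined-by-moments xs 8<n length≡4 sum≡ squares≡ with m≤n⇒∃[o]m+o≡n 8<n
... | t , refl = ↭-trans xs↭ (↭-reflexive (cong₂ _∷_ a≡ rest≡))
  where
  large : ∃ λ a → a ∈ xs × 9 + t < 4 + a
  large = find (large-entry 4 (9 + t) xs (square-excess t sum≡ squares≡))
  a : ℕ
  a = proj₁ large
  split : ∃ λ rest → xs ↭ a ∷ rest
  split = ∈⇒↭∷ (proj₁ (proj₂ large))
  rest : List ℕ
  rest = proj₁ split
  xs↭ : xs ↭ a ∷ rest
  xs↭ = proj₂ split
  sum≡′ : a + sum rest ≡ 9 + t + 2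
  sum≡′ = trans (sym (sum-↭ xs↭)) sum≡
  tail≡ : sum rest ≡ 3 × sumOfSquares rest ≡ 3
  tail≡ = tail-moments t a (sum rest) (sumOfSquares rest) (+-cancelˡ-≤ 4 (6 + t) a (proj₂ (proj₂ large)))
            (sumOfSquares≤sum*sum rest) sum≡′ (trans (cong (_+ (7 + t)) (sym (sumOfSquares-↭ xs↭))) squares≡)
  length≡3 : length rest ≡ 3
  length≡3 = suc-injective (trans (sym (↭-length xs↭)) length≡4)
  shift-one : ∀ t → 9 + t + 2 ≡ 8 + t + 3
  shift-one = solve-∀
  a≡ : a ≡ 8 + t
  a≡ = +-cancelʳ-≡ 3 a (8 + t) (trans (cong (a +_) (sym (proj₁ tail≡))) (trans sum≡′ (shift-one t)))
  rest≡ : rest ≡ 1 ∷ 1 ∷ 1 ∷ []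
  rest≡ = trans (All-≡⇒replicate (sumOfSquares+length≡2*sum⇒ones rest
                  (trans (cong₂ _+_ (proj₂ tail≡) length≡3) (cong (2 *_) (sym (proj₁ tail≡))))))
                (cong (λ l → replicate l 1) length≡3)

-- Indicators and finite sums

∑-*ˡ : ∀ {l} c (f : Fin l → ℕ) → ∑[ i < l ] (c * f i) ≡ c * ∑[ i < l ] f i
∑-*ˡ c f = sym (*-distribˡ-sum c f)

∑-+-*ˡ : ∀ {l} (f g : Fin l → ℕ) c → ∑[ i < l ] (f i + c * g i) ≡ ∑[ i < l ] f i + c * ∑[ i < l ] g i
∑-+-*ˡ {l} f g c = trans (∑-distrib-+ f (λ i → c * g i)) (cong (∑[ i < l ] f i +_) (∑-*ˡ c g))

∑-*ʳ : ∀ {l} c (f : Fin l → ℕ) → ∑[ i < l ] (f i * c) ≡ ∑[ i < l ] f i * c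
∑-*ʳ c f = sym (*-distribʳ-sum c f)

𝕀 : Bool → ℕ
𝕀 true  = 1
𝕀 false = 0

𝕀-∧ : ∀ a b → 𝕀 (a ∧ b) ≡ 𝕀 a * 𝕀 b
𝕀-∧ true  b = sym (+-identityʳ (𝕀 b))
𝕀-∧ false b = refl

𝕀-idem : ∀ a → 𝕀 a * 𝕀 a ≡ 𝕀 a
𝕀-idem true  = refl
𝕀-idem false = refl

count-tabulate : ∀ {A : Set} {v} (p : A → Bool) (g : Fin v → A) →
                 length (filter (λ a → p a Bool.≟ true) (tabulate g)) ≡ ∑[ i < v ] 𝕀 (p (g i))
count-tabulate {v = zero}  p g = refl
count-tabulate {v = suc v} p g with p (g zero)
... | true  = cong suc (count-tabulate p (λ i → g (suc i)))
... | false = count-tabulate p (λ i → g (suc i))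

countB≡∑ : ∀ {v} (p : Fin v → Bool) → countB p ≡ ∑[ x < v ] 𝕀 (p x)
countB≡∑ p = count-tabulate p (λ x → x)

sum-map-tabulate : ∀ {A : Set} {m} (f : A → ℕ) (g : Fin m → A) → sum (map f (tabulate g)) ≡ ∑[ j < m ] f (g j)
sum-map-tabulate {m = zero}  f g = refl
sum-map-tabulate {m = suc m} f g = cong (f (g zero) +_) (sum-map-tabulate f (λ j → g (suc j)))

-- Defined by recursion rather than as 𝕀 ⌊ i ≟ j ⌋, since ⌊ suc i ≟ suc j ⌋ does not reduce to
-- ⌊ i ≟ j ⌋; 𝕀-≟ relates the two.
δ : ∀ {v} → Fin v → Fin v → ℕ
δ zero    zero    = 1
δ zero    (suc _) = 0
δ (suc _) zero    = 0
δ (suc i) (suc j) = δ i j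

δ-refl : ∀ {v} (i : Fin v) → δ i i ≡ 1
δ-refl zero    = refl
δ-refl (suc i) = δ-refl i

δ-≡ : ∀ {v} {i j : Fin v} → i ≡ j → δ i j ≡ 1
δ-≡ {i = i} refl = δ-refl i

δ-≢ : ∀ {v} {i j : Fin v} → i ≢ j → δ i j ≡ 0
δ-≢ {i = zero}  {zero}  i≢j = contradiction refl i≢j
δ-≢ {i = zero}  {suc j} i≢j = refl
δ-≢ {i = suc i} {zero}  i≢j = refl
δ-≢ {i = suc i} {suc j} i≢j = δ-≢ (λ i≡j → i≢j (cong suc i≡j))

δ-subst : ∀ {v} (i j : Fin v) (f : Fin v → ℕ) → δ i j * f i ≡ δ i j * f j
δ-subst i j f with i ≟ j
... | yes refl = refl
... | no i≢j   = trans (cong (_* f i) (δ-≢ i≢j)) (cong (_* f j) (sym (δ-≢ i≢j)))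

𝕀-≟ : ∀ {v} (i j : Fin v) → 𝕀 ⌊ i ≟ j ⌋ ≡ δ i j
𝕀-≟ i j with i ≟ j
... | yes refl = sym (δ-refl i)
... | no i≢j   = sym (δ-≢ i≢j)

∑-δ : ∀ {v} (i : Fin v) (g : Fin v → ℕ) → ∑[ j < v ] (δ i j * g j) ≡ g i
∑-δ {suc v} zero    g = trans (cong₂ _+_ (+-identityʳ (g zero)) (sum-replicate-zero v)) (+-identityʳ (g zero))
∑-δ {suc v} (suc i) g = ∑-δ i (λ j → g (suc j))

-- The quotient matrix of a divisible design graph

module QuotientMatrix {v k λ₁ λ₂ m n} {G : Graph v} {cls : Fin v → Fin m}
           (ddg : IsDDG G k λ₁ λ₂ m n cls) (λ₂<λ₁ : λ₂ < λ₁) .{{_ : NonZero n}} where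

  open IsDDG ddg

  d : ℕ
  d = λ₁ ∸ λ₂

  instance
    d-nonZero : NonZero d
    d-nonZero = >-nonZero (m<n⇒0<n∸m λ₂<λ₁)

  λ₂+d≡λ₁ : λ₂ + d ≡ λ₁
  λ₂+d≡λ₁ = m+[n∸m]≡n (<⇒≤ λ₂<λ₁)

  A : Fin v → Fin v → ℕ
  A x y = 𝕀 (adj G x y)

  A-sym : ∀ x y → A x y ≡ A y x
  A-sym x y = cong 𝕀 (Graph.sym G x y)

  degree≡k : ∀ x → ∑[ y < v ] A x y ≡ k
  degree≡k x = trans (sym (countB≡∑ (adj G x))) (regular x)

  commonNbrs≡∑ : ∀ x y → commonNbrs G x y ≡ ∑[ z < v ] (A x z * A y z)
  commonNbrs≡∑ x y = trans (countB≡∑ (λ z → adj G x z ∧ adj G y z)) (sum-cong-≗ (λ z → 𝕀-∧ (adj G x z) (adj G y z)))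

  A· : (Fin v → ℕ) → Fin v → ℕ
  A· g x = ∑[ y < v ] (A x y * g y)

  inClass : Fin m → Fin v → ℕ
  inClass i y = δ (cls y) i

  classSum : (Fin v → ℕ) → Fin m → ℕ
  classSum g i = ∑[ y < v ] (inClass i y * g y)

  r : Fin m → Fin v → ℕ
  r j = A· (inClass j)

  r≡nbrsIn : ∀ x j → r j x ≡ nbrsIn G cls x j
  r≡nbrsIn x j = sym (trans (countB≡∑ (λ z → adj G x z ∧ ⌊ cls z ≟ j ⌋))
    (sum-cong-≗ (λ z → trans (𝕀-∧ (adj G x z) _) (cong (A x z *_) (𝕀-≟ (cls z) j)))))

  classSize≡n : ∀ i → ∑[ y < v ] inClass i y ≡ n
  classSize≡n i =
    trans (sum-cong-≗ (λ y → sym (𝕀-≟ (cls y) i))) (trans (sym (countB≡∑ (λ y → ⌊ cls y ≟ i ⌋))) (classSz i))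

  A·-+ : ∀ g h x → A· (λ y → g y + h y) x ≡ A· g x + A· h x
  A·-+ g h x =
    trans (sum-cong-≗ (λ y → *-distribˡ-+ (A x y) (g y) (h y))) (∑-distrib-+ (λ y → A x y * g y) (λ y → A x y * h y))

  A·-* : ∀ c g x → A· (λ y → c * g y) x ≡ c * A· g x
  A·-* c g x = trans (sum-cong-≗ (λ y → x∙yz≈y∙xz (A x y) c (g y))) (∑-*ˡ c (λ y → A x y * g y))

  A·-const : ∀ c x → A· (λ _ → c) x ≡ k * c
  A·-const c x = trans (∑-*ʳ c (A x)) (cong (_* c) (degree≡k x))

  A²≡∑commonNbrs : ∀ g x → A· (A· g) x ≡ ∑[ y < v ] (∑[ z < v ] (A x z * A y z) * g y)
  A²≡∑commonNbrs g x = begin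
    ∑[ z < v ] (A x z * ∑[ y < v ] (A z y * g y))     ≡⟨ sum-cong-≗ (λ z → ∑-*ˡ (A x z) (λ y → A z y * g y)) ⟨
    ∑[ z < v ] ∑[ y < v ] (A x z * (A z y * g y))     ≡⟨ ∑-comm (λ z y → A x z * (A z y * g y)) ⟩
    ∑[ y < v ] ∑[ z < v ] (A x z * (A z y * g y))     ≡⟨ sum-cong-≗ (λ y → sum-cong-≗ (λ z → regroup x y z)) ⟩
    ∑[ y < v ] ∑[ z < v ] (A x z * A y z * g y)       ≡⟨ sum-cong-≗ (λ y → ∑-*ʳ (g y) (λ z → A x z * A y z)) ⟩
    ∑[ y < v ] (∑[ z < v ] (A x z * A y z) * g y)     ∎
    where
    open ≡-Reasoning
    regroup : ∀ x y z → A x z * (A z y * g y) ≡ A x z * A y z * g y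
    regroup x y z = trans (sym (*-assoc (A x z) (A z y) (g y))) (cong (λ a → A x z * a * g y) (A-sym z y))

  -- The (x, y) entry of A² + λ₁ I = λ₂ J + d K + k I.
  commonNbrs-decomposition : ∀ x y → ∑[ z < v ] (A x z * A y z) + λ₁ * δ x y ≡ λ₂ + d * inClass (cls x) y + k * δ x y
  commonNbrs-decomposition x y with x ≟ y
  ... | yes refl = begin
    ∑[ z < v ] (A x z * A x z) + λ₁ * δ x x      ≡⟨ cong₂ (λ c e → c + λ₁ * e) diagonal (δ-refl x) ⟩
    k + λ₁ * 1                                    ≡⟨ cong (λ l → k + l * 1) λ₂+d≡λ₁ ⟨
    k + (λ₂ + d) * 1                              ≡⟨ rearrange k λ₂ d ⟩
    λ₂ + d * 1 + k * 1                            ≡⟨ cong₂ (λ e e′ → λ₂ + d * e + k * e′) (δ-refl (cls x)) (δ-refl x) ⟨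
    λ₂ + d * δ (cls x) (cls x) + k * δ x x        ∎
    where
    open ≡-Reasoning
    diagonal : ∑[ z < v ] (A x z * A x z) ≡ k
    diagonal = trans (sum-cong-≗ (λ z → 𝕀-idem (adj G x z))) (degree≡k x)
    rearrange : ∀ k a b → k + (a + b) * 1 ≡ a + b * 1 + k * 1
    rearrange = solve-∀
  ... | no x≢y with cls y ≟ cls x
  ...   | yes same = begin
    ∑[ z < v ] (A x z * A y z) + λ₁ * δ x y      ≡⟨ cong₂ (λ c e → c + λ₁ * e) common (δ-≢ x≢y) ⟩
    λ₁ + λ₁ * 0                                   ≡⟨ cong (λ l → l + l * 0) λ₂+d≡λ₁ ⟨
    λ₂ + d + (λ₂ + d) * 0                         ≡⟨ rearrange λ₂ d k ⟩
    λ₂ + d * 1 + k * 0                            ≡⟨ cong₂ (λ e e′ → λ₂ + d * e + k * e′) (δ-≡ same) (δ-≢ x≢y) ⟨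
    λ₂ + d * δ (cls y) (cls x) + k * δ x y        ∎
    where
    open ≡-Reasoning
    common : ∑[ z < v ] (A x z * A y z) ≡ λ₁
    common = trans (sym (commonNbrs≡∑ x y)) (sameClass x y x≢y (sym same))
    rearrange : ∀ a b k → a + b + (a + b) * 0 ≡ a + b * 1 + k * 0
    rearrange = solve-∀
  ...   | no different = begin
    ∑[ z < v ] (A x z * A y z) + λ₁ * δ x y      ≡⟨ cong₂ (λ c e → c + λ₁ * e) common (δ-≢ x≢y) ⟩
    λ₂ + λ₁ * 0                                   ≡⟨ rearrange λ₂ λ₁ d k ⟩
    λ₂ + d * 0 + k * 0                            ≡⟨ cong₂ (λ e e′ → λ₂ + d * e + k * e′) (δ-≢ different) (δ-≢ x≢y) ⟨
    λ₂ + d * δ (cls y) (cls x) + k * δ x y        ∎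
    where
    open ≡-Reasoning
    common : ∑[ z < v ] (A x z * A y z) ≡ λ₂
    common = trans (sym (commonNbrs≡∑ x y)) (diffClass x y (λ eq → different (sym eq)))
    rearrange : ∀ a l d k → a + l * 0 ≡ a + d * 0 + k * 0
    rearrange = solve-∀

  A²-action : ∀ g x → A· (A· g) x + λ₁ * g x ≡ λ₂ * ∑[ y < v ] g y + d * classSum g (cls x) + k * g x
  A²-action g x = begin
    A· (A· g) x + λ₁ * g x
      ≡⟨ cong₂ (λ s t → s + λ₁ * t) (A²≡∑commonNbrs g x) (sym (∑-δ x g)) ⟩
    ∑[ y < v ] (C y * g y) + λ₁ * ∑[ y < v ] (δ x y * g y)
      ≡⟨ ∑-+-*ˡ (λ y → C y * g y) (λ y → δ x y * g y) λ₁ ⟨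
    ∑[ y < v ] (C y * g y + λ₁ * (δ x y * g y))
      ≡⟨ sum-cong-≗ pointwise ⟩
    ∑[ y < v ] (λ₂ * g y + d * (inClass (cls x) y * g y) + k * (δ x y * g y))
      ≡⟨ ∑-+-*ˡ (λ y → λ₂ * g y + d * (inClass (cls x) y * g y)) (λ y → δ x y * g y) k ⟩
    ∑[ y < v ] (λ₂ * g y + d * (inClass (cls x) y * g y)) + k * ∑[ y < v ] (δ x y * g y)
      ≡⟨ cong (_+ k * ∑[ y < v ] (δ x y * g y)) (∑-+-*ˡ (λ y → λ₂ * g y) (λ y → inClass (cls x) y * g y) d) ⟩
    ∑[ y < v ] (λ₂ * g y) + d * classSum g (cls x) + k * ∑[ y < v ] (δ x y * g y)
      ≡⟨ cong₂ (λ s t → s + d * classSum g (cls x) + k * t) (∑-*ˡ λ₂ g) (∑-δ x g) ⟩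
    λ₂ * ∑[ y < v ] g y + d * classSum g (cls x) + k * g x
      ∎
    where
    open ≡-Reasoning
    C : Fin v → ℕ
    C y = ∑[ z < v ] (A x z * A y z)
    factor : ∀ c l e g → c * g + l * (e * g) ≡ (c + l * e) * g
    factor = solve-∀
    expand : ∀ a b c i e g → (a + b * i + c * e) * g ≡ a * g + b * (i * g) + c * (e * g)
    expand = solve-∀
    pointwise : ∀ y → C y * g y + λ₁ * (δ x y * g y) ≡ λ₂ * g y + d * (inClass (cls x) y * g y) + k * (δ x y * g y)
    pointwise y = begin
      C y * g y + λ₁ * (δ x y * g y)                 ≡⟨ factor (C y) λ₁ (δ x y) (g y) ⟩
      (C y + λ₁ * δ x y) * g y                       ≡⟨ cong (_* g y) (commonNbrs-decomposition x y) ⟩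
      (λ₂ + d * inClass (cls x) y + k * δ x y) * g y ≡⟨ expand λ₂ d k (inClass (cls x) y) (δ x y) (g y) ⟩
      λ₂ * g y + d * (inClass (cls x) y * g y) + k * (δ x y * g y) ∎

  classSum-inClass : ∀ i j → classSum (inClass j) i ≡ n * δ i j
  classSum-inClass i j = begin
    ∑[ y < v ] (δ (cls y) i * δ (cls y) j)  ≡⟨ sum-cong-≗ (λ y → δ-subst (cls y) i (λ c → δ c j)) ⟩
    ∑[ y < v ] (δ (cls y) i * δ i j)        ≡⟨ ∑-*ʳ (δ i j) (inClass i) ⟩
    ∑[ y < v ] inClass i y * δ i j          ≡⟨ cong (_* δ i j) (classSize≡n i) ⟩
    n * δ i j                               ∎
    where open ≡-Reasoning

  A²-on-class : ∀ j z → A· (r j) z + λ₁ * inClass j z ≡ λ₂ * n + (d * n + k) * inClass j z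
  A²-on-class j z = begin
    A· (r j) z + λ₁ * inClass j z
      ≡⟨ A²-action (inClass j) z ⟩
    λ₂ * ∑[ y < v ] inClass j y + d * classSum (inClass j) (cls z) + k * inClass j z
      ≡⟨ cong₂ (λ s c → λ₂ * s + d * c + k * inClass j z) (classSize≡n j) (classSum-inClass (cls z) j) ⟩
    λ₂ * n + d * (n * inClass j z) + k * inClass j z
      ≡⟨ collect λ₂ n d k (inClass j z) ⟩
    λ₂ * n + (d * n + k) * inClass j z
      ∎
    where
    open ≡-Reasoning
    collect : ∀ a n d k e → a * n + d * (n * e) + k * e ≡ a * n + (d * n + k) * e
    collect = solve-∀

  ∑-A· : ∀ g → ∑[ x < v ] A· g x ≡ k * ∑[ y < v ] g y
  ∑-A· g = begin
    ∑[ x < v ] ∑[ y < v ] (A x y * g y)  ≡⟨ ∑-comm (λ x y → A x y * g y) ⟩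
    ∑[ y < v ] ∑[ x < v ] (A x y * g y)  ≡⟨ sum-cong-≗ (λ y → ∑-*ʳ (g y) (λ x → A x y)) ⟩
    ∑[ y < v ] (∑[ x < v ] A x y * g y)  ≡⟨ sum-cong-≗ (λ y → cong (_* g y) (trans (sum-cong-≗ (λ x → A-sym x y)) (degree≡k y))) ⟩
    ∑[ y < v ] (k * g y)                 ≡⟨ ∑-*ˡ k g ⟩
    k * ∑[ y < v ] g y                   ∎
    where open ≡-Reasoning

  A³-on-class : ∀ j x → A· (A· (r j)) x + λ₁ * r j x ≡ k * (λ₂ * n) + (d * n + k) * r j x
  A³-on-class j x = begin
    A· (A· (r j)) x + λ₁ * r j x
      ≡⟨ cong (A· (A· (r j)) x +_) (A·-* λ₁ (inClass j) x) ⟨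
    A· (A· (r j)) x + A· (λ z → λ₁ * inClass j z) x
      ≡⟨ A·-+ (A· (r j)) (λ z → λ₁ * inClass j z) x ⟨
    A· (λ z → A· (r j) z + λ₁ * inClass j z) x
      ≡⟨ sum-cong-≗ (λ z → cong (A x z *_) (A²-on-class j z)) ⟩
    A· (λ z → λ₂ * n + (d * n + k) * inClass j z) x
      ≡⟨ A·-+ (λ _ → λ₂ * n) (λ z → (d * n + k) * inClass j z) x ⟩
    A· (λ _ → λ₂ * n) x + A· (λ z → (d * n + k) * inClass j z) x
      ≡⟨ cong₂ _+_ (A·-const (λ₂ * n) x) (A·-* (d * n + k) (inClass j) x) ⟩
    k * (λ₂ * n) + (d * n + k) * r j x
      ∎
    where open ≡-Reasoning

  ∑r≡k*n : ∀ j → ∑[ y < v ] r j y ≡ k * n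
  ∑r≡k*n j = trans (∑-A· (inClass j)) (cong (k *_) (classSize≡n j))

  -- Compare A (A² 1_{V_j}) with A² (A 1_{V_j}) and cancel d = λ₁ − λ₂ ≠ 0.
  equitable : ∀ j x → n * r j x ≡ classSum (r j) (cls x)
  equitable j x = *-cancelˡ-≡ _ _ d (+-cancelˡ-≡ (k * (λ₂ * n) + k * r j x) _ _ (begin
    k * (λ₂ * n) + k * r j x + d * (n * r j x)   ≡⟨ collect k λ₂ n d (r j x) ⟩
    k * (λ₂ * n) + (d * n + k) * r j x           ≡⟨ A³-on-class j x ⟨
    A· (A· (r j)) x + λ₁ * r j x                 ≡⟨ A²-action (r j) x ⟩
    λ₂ * ∑[ y < v ] r j y + d * T + k * r j x    ≡⟨ cong (λ s → λ₂ * s + d * T + k * r j x) (∑r≡k*n j) ⟩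
    λ₂ * (k * n) + d * T + k * r j x             ≡⟨ collect′ λ₂ k n (d * T) (r j x) ⟩
    k * (λ₂ * n) + k * r j x + d * T             ∎))
    where
    open ≡-Reasoning
    T : ℕ
    T = classSum (r j) (cls x)
    collect : ∀ k a n d f → k * (a * n) + k * f + d * (n * f) ≡ k * (a * n) + (d * n + k) * f
    collect = solve-∀
    collect′ : ∀ a k n t f → a * (k * n) + t + k * f ≡ k * (a * n) + k * f + t
    collect′ = solve-∀

  classSum-sym : ∀ i j → classSum (r j) i ≡ classSum (r i) j
  classSum-sym i j = begin
    ∑[ y < v ] (inClass i y * ∑[ z < v ] (A y z * inClass j z))
      ≡⟨ sum-cong-≗ (λ y → ∑-*ˡ (inClass i y) (λ z → A y z * inClass j z)) ⟨
    ∑[ y < v ] ∑[ z < v ] (inClass i y * (A y z * inClass j z))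
      ≡⟨ ∑-comm (λ y z → inClass i y * (A y z * inClass j z)) ⟩
    ∑[ z < v ] ∑[ y < v ] (inClass i y * (A y z * inClass j z))
      ≡⟨ sum-cong-≗ (λ z → sum-cong-≗ (λ y → reverse y z)) ⟩
    ∑[ z < v ] ∑[ y < v ] (inClass j z * (A z y * inClass i y))
      ≡⟨ sum-cong-≗ (λ z → ∑-*ˡ (inClass j z) (λ y → A z y * inClass i y)) ⟩
    ∑[ z < v ] (inClass j z * ∑[ y < v ] (A z y * inClass i y))
      ∎
    where
    open ≡-Reasoning
    reorder : ∀ a b c → a * (b * c) ≡ c * (b * a)
    reorder = solve-∀
    reverse : ∀ y z → inClass i y * (A y z * inClass j z) ≡ inClass j z * (A z y * inClass i y)
    reverse y z = trans (cong (λ a → inClass i y * (a * inClass j z)) (A-sym y z)) (reorder (inClass i y) (A z y) (inClass j z))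

  r-sym : ∀ x z → r (cls z) x ≡ r (cls x) z
  r-sym x z = *-cancelˡ-≡ _ _ n (begin
    n * r (cls z) x                  ≡⟨ equitable (cls z) x ⟩
    classSum (r (cls z)) (cls x)     ≡⟨ classSum-sym (cls x) (cls z) ⟩
    classSum (r (cls x)) (cls z)     ≡⟨ equitable (cls x) z ⟨
    n * r (cls x) z                  ∎)
    where open ≡-Reasoning

  row-sum : ∀ x → ∑[ j < m ] r j x ≡ k
  row-sum x = begin
    ∑[ j < m ] ∑[ y < v ] (A x y * δ (cls y) j)  ≡⟨ ∑-comm (λ j y → A x y * δ (cls y) j) ⟩
    ∑[ y < v ] ∑[ j < m ] (A x y * δ (cls y) j)  ≡⟨ sum-cong-≗ (λ y → trans (sum-cong-≗ (λ j → *-comm (A x y) (δ (cls y) j))) (∑-δ (cls y) (λ _ → A x y))) ⟩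
    ∑[ y < v ] A x y                            ≡⟨ degree≡k x ⟩
    k                                           ∎
    where open ≡-Reasoning

  ∑r²≡A· : ∀ x → ∑[ j < m ] (r j x * r j x) ≡ A· (r (cls x)) x
  ∑r²≡A· x = begin
    ∑[ j < m ] (r j x * r j x)
      ≡⟨ sum-cong-≗ (λ j → ∑-*ʳ (r j x) (λ z → A x z * δ (cls z) j)) ⟨
    ∑[ j < m ] ∑[ z < v ] (A x z * δ (cls z) j * r j x)
      ≡⟨ ∑-comm (λ j z → A x z * δ (cls z) j * r j x) ⟩
    ∑[ z < v ] ∑[ j < m ] (A x z * δ (cls z) j * r j x)
      ≡⟨ sum-cong-≗ (λ z → trans (sum-cong-≗ (λ j → *-assoc (A x z) (δ (cls z) j) (r j x))) (∑-*ˡ (A x z) (λ j → δ (cls z) j * r j x))) ⟩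
    ∑[ z < v ] (A x z * ∑[ j < m ] (δ (cls z) j * r j x))
      ≡⟨ sum-cong-≗ (λ z → cong (A x z *_) (trans (∑-δ (cls z) (λ j → r j x)) (r-sym x z))) ⟩
    ∑[ z < v ] (A x z * r (cls x) z)
      ∎
    where open ≡-Reasoning

  row-squares : ∀ x → ∑[ j < m ] (r j x * r j x) + λ₁ ≡ λ₁ * n + k
  row-squares x = begin
    ∑[ j < m ] (r j x * r j x) + λ₁              ≡⟨ cong₂ _+_ (∑r²≡A· x) (sym (*-identityʳ λ₁)) ⟩
    A· (r (cls x)) x + λ₁ * 1                    ≡⟨ cong (λ e → A· (r (cls x)) x + λ₁ * e) (δ-refl (cls x)) ⟨
    A· (r (cls x)) x + λ₁ * inClass (cls x) x    ≡⟨ A²-on-class (cls x) x ⟩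
    λ₂ * n + (d * n + k) * inClass (cls x) x     ≡⟨ cong (λ e → λ₂ * n + (d * n + k) * e) (δ-refl (cls x)) ⟩
    λ₂ * n + (d * n + k) * 1                     ≡⟨ collect λ₂ d n k ⟩
    (λ₂ + d) * n + k                             ≡⟨ cong (λ l → l * n + k) λ₂+d≡λ₁ ⟩
    λ₁ * n + k                                   ∎
    where
    open ≡-Reasoning
    collect : ∀ a d n k → a * n + (d * n + k) * 1 ≡ (a + d) * n + k
    collect = solve-∀

  quotientRow-sum : ∀ x → sum (quotientRow G cls x) ≡ k
  quotientRow-sum x = begin
    sum (map (nbrsIn G cls x) (allFin m))  ≡⟨ sum-map-tabulate (nbrsIn G cls x) (λ j → j) ⟩
    ∑[ j < m ] nbrsIn G cls x j            ≡⟨ sum-cong-≗ (r≡nbrsIn x) ⟨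
    ∑[ j < m ] r j x                       ≡⟨ row-sum x ⟩
    k                                      ∎
    where open ≡-Reasoning

  quotientRow-sumOfSquares : ∀ x → sumOfSquares (quotientRow G cls x) + λ₁ ≡ λ₁ * n + k
  quotientRow-sumOfSquares x = begin
    sum (map (λ c → c * c) (map (nbrsIn G cls x) (allFin m))) + λ₁
      ≡⟨ cong (λ l → sum l + λ₁) (map-∘ (allFin m)) ⟨
    sum (map (λ j → nbrsIn G cls x j * nbrsIn G cls x j) (allFin m)) + λ₁
      ≡⟨ cong (_+ λ₁) (sum-map-tabulate (λ j → nbrsIn G cls x j * nbrsIn G cls x j) (λ j → j)) ⟩
    ∑[ j < m ] (nbrsIn G cls x j * nbrsIn G cls x j) + λ₁
      ≡⟨ cong (_+ λ₁) (sum-cong-≗ (λ j → cong₂ _*_ (r≡nbrsIn x j) (r≡nbrsIn x j))) ⟨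
    ∑[ j < m ] (r j x * r j x) + λ₁
      ≡⟨ row-squares x ⟩
    λ₁ * n + k
      ∎
    where open ≡-Reasoning

proposition5 : (n : ℕ) → n > 8 →
    (G : Graph (4 * n)) → (cls : Fin (4 * n) → Fin 4) →
    IsDDG G (n + 2) (n ∸ 2) 2 4 n cls →
    (x : Fin (4 * n)) →
    quotientRow G cls x ↭ ((n ∸ 1) ∷ 1 ∷ 1 ∷ 1 ∷ [])
proposition5 n 8<n G cls ddg x =
  row-determined-by-moments (quotientRow G cls x) 8<n refl (quotientRow-sum x) (quotientRow-sumOfSquares x)
  where
  instance
    n-nonZero : NonZero n
    n-nonZero = >-nonZero (≤-trans (s≤s z≤n) 8<n)
  2<n∸2 : 2 < n ∸ 2
  2<n∸2 = m+n≤o⇒m≤o∸n 3 (≤-trans (m≤m+n 5 4) 8<n)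
  open QuotientMatrix ddg 2<n∸2
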